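{- Let $D=(V,E)$ be a digraph and let $u,v\in V$ be distinct vertices. Suppose that the arc $(u,v)$ has multiplicity $n$ and the arc $(v,u)$ has multiplicity $m$ in $E$. Let $D_3$ be the digraph obtained from $D$ by deleting all $n$ arcs $(u,v)$ and all $m$ arcs $(v,u)$. Let $D_1$ be $D_3$ with one arc $(u,v)$ added, and let $D_2$ be $D_3$ with one arc $(v,u)$ added. Then \[ \sigma(D)=n\sigma(D_1)+m\sigma(D_2)-(n+m-1)\sigma(D_3)+nm x^2 \] and \[ \pi(D)=n\pi(D_1)+m\pi(D_2)-(n+m-1)\pi(D_3). \]
   Context: Digraphs are finite directed multigraphs; loops and multiple arcs are allowed. A directed cycle of length $k\ge1$ consists of $k$ distinct vertices $v_1,\dots,v_k$ and arcs $(v_1,v_2),\dots,(v_k,v_1)$. A loop is a cycle of length 1 and two opposite arcs form a cycle of length 2. A directed path of length $k\ge1$ consists of $k+1$ distinct vertices $v_0,\dots,v_k$ and arcs $(v_0,v_1),\dots,(v_{k-1},v_k)$. Cycles and paths are counted as arc sets, so parallel arcs give different cycles and paths. The cycle polynomial is $\sigma(D;x)=\sum_{k\ge1}c_k(D)x^k$ and the path polynomial is $\pi(D;x)=\sum_{k\ge1}p_k(D)x^k$, where $c_k(D)$ and $p_k(D)$ are the numbers of directed cycles and directed paths of length $k$ in $D$. -}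

module Defs where

open import Data.Nat using (ℕ; zero; suc) renaming (_≟_ to _≟ℕ_)
open import Data.Fin using (Fin; zero; suc; inject₁; fromℕ; _≤_; _≤?_) renaming (_≟_ to _≟F_)
open import Data.Fin.Properties using (all?)
open import Data.Product using (_×_; _,_; proj₁; proj₂)
open import Data.Product.Properties using (≡-dec)
open import Data.Sum using (_⊎_)
open import Data.List using (List; []; _∷_; length; lookup; filter; map; concatMap; [_]; allFin)
open import Data.List.Membership.Propositional using ()
open import Data.Vec.Functional using () renaming (_∷_ to _∷ᶠ_)
open import Data.Integer using (ℤ; +_)
open import Relation.Binary.PropositionalEquality using (_≡_; _≢_)
open import Relation.Binary.Definitions using (DecidableEquality)
open import Relation.Nullary using (Dec; ¬_; ¬?; yes; no)
open import Relation.Nullary.Decidable using (_×-dec_; _→-dec_; _⊎-dec_)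

-- Loops and repeated entries (parallel arcs) are allowed; the arcs of D
-- are identified by their position in the list, so parallel arcs are
-- distinct arcs.
Arc : ℕ → Set
Arc N = Fin N × Fin N

Digraph : ℕ → Set
Digraph N = List (Arc N)

_≟A_ : ∀ {N} → DecidableEquality (Arc N)
_≟A_ = ≡-dec _≟F_ _≟F_

ArcOf : ∀ {N} → Digraph N → Set
ArcOf D = Fin (length D)

tl hd : ∀ {N} (D : Digraph N) → ArcOf D → Fin N
tl D e = proj₁ (lookup D e)
hd D e = proj₂ (lookup D e)

mult : ∀ {N} → Digraph N → Fin N → Fin N → ℕ
mult D u v = length (filter (λ a → a ≟A (u , v)) D)

deleteBoth : ∀ {N} → Digraph N → Fin N → Fin N → Digraph N
deleteBoth D u v = filter (λ a → ¬? ((a ≟A (u , v)) ⊎-dec (a ≟A (v , u)))) D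

addArc : ∀ {N} → Digraph N → Fin N → Fin N → Digraph N
addArc D u v = (u , v) ∷ D

allFuns : ∀ {a} ℓ → List (Fin ℓ → Fin a)
allFuns zero = [ (λ ()) ]
allFuns {a} (suc ℓ) =
  concatMap (λ x → map (λ f → x ∷ᶠ f) (allFuns ℓ)) (allFin a)

Injective : ∀ {ℓ N} → (Fin ℓ → Fin N) → Set
Injective w = ∀ i j → w i ≡ w j → i ≡ j

injective? : ∀ {ℓ N} (w : Fin ℓ → Fin N) → Dec (Injective w)
injective? w = all? λ i → all? λ j → (w i ≟F w j) →-dec (i ≟F j)

-- A directed cycle (as an arc set) e_0,…,e_k with vertices v_i = tail e_i
-- is represented by exactly one arc sequence, namely the rotation in which
-- the first vertex v_0 is the smallest one.

IsCycleSeq : ∀ {N} (D : Digraph N) k → (Fin (suc k) → ArcOf D) → Set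
IsCycleSeq D k e =
    (∀ (i : Fin k) → hd D (e (inject₁ i)) ≡ tl D (e (suc i)))
  × (hd D (e (fromℕ k)) ≡ tl D (e zero))
  × Injective (λ i → tl D (e i))
  × (∀ i → tl D (e zero) ≤ tl D (e i))

isCycleSeq? : ∀ {N} (D : Digraph N) k e → Dec (IsCycleSeq D k e)
isCycleSeq? D k e =
       all? (λ i → hd D (e (inject₁ i)) ≟F tl D (e (suc i)))
  ×-dec (hd D (e (fromℕ k)) ≟F tl D (e zero))
  ×-dec injective? (λ i → tl D (e i))
  ×-dec all? (λ i → tl D (e zero) ≤? tl D (e i))

cycles : ∀ {N} → Digraph N → ℕ → ℕ
cycles D zero = 0
cycles D (suc k) = length (filter (isCycleSeq? D k) (allFuns (suc k)))

-- Directed paths of length suc k: arcs e_0,…,e_k with vertices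
-- v_0 = tail e_0, v_(i+1) = head e_i, all distinct.  (A path is
-- determined by, and determines, its arc sequence.)

pathVerts : ∀ {N} (D : Digraph N) k → (Fin (suc k) → ArcOf D) → Fin (suc (suc k)) → Fin N
pathVerts D k e zero = tl D (e zero)
pathVerts D k e (suc i) = hd D (e i)

IsPathSeq : ∀ {N} (D : Digraph N) k → (Fin (suc k) → ArcOf D) → Set
IsPathSeq D k e =
    (∀ (i : Fin k) → hd D (e (inject₁ i)) ≡ tl D (e (suc i)))
  × Injective (pathVerts D k e)

isPathSeq? : ∀ {N} (D : Digraph N) k e → Dec (IsPathSeq D k e)
isPathSeq? D k e =
       all? (λ i → hd D (e (inject₁ i)) ≟F tl D (e (suc i)))
  ×-dec injective? (pathVerts D k e)

paths : ∀ {N} → Digraph N → ℕ → ℕ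
paths D zero = 0
paths D (suc k) = length (filter (isPathSeq? D k) (allFuns (suc k)))

Poly : Set
Poly = ℕ → ℤ

σ : ∀ {N} → Digraph N → Poly
σ D k = + cycles D k

π : ∀ {N} → Digraph N → Poly
π D k = + paths D k

X^ : ℕ → Poly
X^ j k with j ≟ℕ k
... | yes _ = + 1
... | no _ = + 0

-- Enumerating the arc sequences of D through their labels turns c_k(D) and p_k(D) into sums of
-- an indicator over words of length k in the arc list of D.  Split the letters into those of D₃
-- and the two letters (u,v), (v,u), of multiplicities n and m: the word sum becomes a polynomial
-- in n and m, and since no cycle or path uses an arc twice it is affine in each variable.  It is
-- therefore determined by its values at n, m ∈ {0, 1}, which are the counts in D₃, D₁ and D₂, and
-- by its mixed second difference, which counts the cycles/paths using both (u,v) and (v,u).  No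
-- path does, and a cycle does only if it is the 2-cycle u → v → u, which is counted once.

module Submission where

open import Defs
open import Data.Nat using (ℕ; zero; suc)
open import Data.Fin using (Fin; zero; suc; toℕ; inject₁; fromℕ; _≤_; _≤?_) renaming (_≟_ to _≟F_)
open import Data.Fin.Properties
  using (suc-injective; toℕ-injective; toℕ-fromℕ; toℕ-inject₁; all?; ≤-total; ≤-antisym; ≤-refl)
open import Data.Fin.Relation.Unary.Top using (view; ‵fromℕ; ‵inject₁)
open import Data.Nat.Properties using (m≢1+n+m)
open import Data.Sum using (_⊎_; inj₁; inj₂)
open import Data.Product using (_×_; _,_; proj₁; proj₂; Σ)
open import Data.List using (List; []; _∷_; length; lookup; filter; map; concatMap; allFin; tabulate; _++_)
open import Data.List.Properties using (map-tabulate; tabulate-lookup; filter-≐)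
open import Data.Vec.Functional using () renaming ([] to []ᶠ; _∷_ to _∷ᶠ_)
open import Data.Integer using (ℤ; +_; _+_; _-_; _*_; -_)
open import Data.Integer.Properties
  using (+-identityˡ; +-identityʳ; +-assoc; *-zeroʳ; *-distribˡ-+; neg-distrib-+; +-commutativeSemigroup)
open import Algebra.Properties.CommutativeSemigroup +-commutativeSemigroup using (interchange; xy∙z≈xz∙y)
open import Data.Integer.Tactic.RingSolver using (solve-∀; solve)
open import Data.Empty using (⊥-elim)
open import Function using (id; _∘_; _⇔_; mk⇔; Equivalence; case_of_)
open import Relation.Binary.PropositionalEquality
open import Relation.Nullary using (Dec; yes; no; ¬_; ¬?)
open import Relation.Nullary.Decidable using (_⊎-dec_; _×-dec_)
open import Relation.Binary.Definitions using (DecidableEquality)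

open ≡-Reasoning

private
  variable
    A : Set
    ℓ : ℕ

𝟙 : ∀ {P : Set} → Dec P → ℤ
𝟙 (yes _) = + 1
𝟙 (no _) = + 0

𝟙-cong : ∀ {P Q : Set} (p : Dec P) (q : Dec Q) → P ⇔ Q → 𝟙 p ≡ 𝟙 q
𝟙-cong (yes _) (yes _) _ = refl
𝟙-cong (yes p) (no ¬q) P⇔Q = ⊥-elim (¬q (Equivalence.to P⇔Q p))
𝟙-cong (no ¬p) (yes q) P⇔Q = ⊥-elim (¬p (Equivalence.from P⇔Q q))
𝟙-cong (no _) (no _) _ = refl

𝟙-yes : ∀ {P : Set} (p : Dec P) → P → 𝟙 p ≡ + 1
𝟙-yes (yes _) _ = refl
𝟙-yes (no ¬p) p = ⊥-elim (¬p p)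

𝟙-no : ∀ {P : Set} (p : Dec P) → ¬ P → 𝟙 p ≡ + 0
𝟙-no (yes p) ¬p = ⊥-elim (¬p p)
𝟙-no (no _) _ = refl

∑ : List A → (A → ℤ) → ℤ
∑ [] f = + 0
∑ (x ∷ xs) f = f x + ∑ xs f

∑-cong : ∀ (xs : List A) {f g : A → ℤ} → f ≗ g → ∑ xs f ≡ ∑ xs g
∑-cong [] f≗g = refl
∑-cong (x ∷ xs) f≗g = cong₂ _+_ (f≗g x) (∑-cong xs f≗g)

∑-zero : ∀ (xs : List A) {f : A → ℤ} → (∀ x → f x ≡ + 0) → ∑ xs f ≡ + 0
∑-zero [] f≗0 = refl
∑-zero (x ∷ xs) f≗0 = cong₂ _+_ (f≗0 x) (∑-zero xs f≗0)

∑-+ : ∀ (xs : List A) (f g : A → ℤ) → ∑ xs (λ x → f x + g x) ≡ ∑ xs f + ∑ xs g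
∑-+ [] f g = refl
∑-+ (x ∷ xs) f g = trans (cong (_+_ (f x + g x)) (∑-+ xs f g)) (interchange (f x) (g x) _ _)

∑-- : ∀ (xs : List A) (f g : A → ℤ) → ∑ xs (λ x → f x - g x) ≡ ∑ xs f - ∑ xs g
∑-- [] f g = refl
∑-- (x ∷ xs) f g = begin
  f x - g x + ∑ xs (λ x → f x - g x)   ≡⟨ cong (_+_ (f x - g x)) (∑-- xs f g) ⟩
  f x - g x + (∑ xs f - ∑ xs g)        ≡⟨ interchange (f x) (- g x) _ _ ⟩
  f x + ∑ xs f + (- g x - ∑ xs g)      ≡⟨ cong (_+_ (f x + ∑ xs f)) (neg-distrib-+ (g x) _) ⟨
  f x + ∑ xs f - (g x + ∑ xs g)        ∎

∑-*ˡ : ∀ (xs : List A) (n : ℤ) (f : A → ℤ) → ∑ xs (λ x → n * f x) ≡ n * ∑ xs f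
∑-*ˡ [] n f = sym (*-zeroʳ n)
∑-*ˡ (x ∷ xs) n f = trans (cong (_+_ (n * f x)) (∑-*ˡ xs n f)) (sym (*-distribˡ-+ n (f x) _))

∑-affine : ∀ (xs : List A) (n : ℤ) {f g h : A → ℤ} → (∀ x → f x ≡ g x + n * (h x - g x)) →
  ∑ xs f ≡ ∑ xs g + n * (∑ xs h - ∑ xs g)
∑-affine xs n {f} {g} {h} f≗ = begin
  ∑ xs f                                   ≡⟨ ∑-cong xs f≗ ⟩
  ∑ xs (λ x → g x + n * (h x - g x))       ≡⟨ ∑-+ xs g _ ⟩
  ∑ xs g + ∑ xs (λ x → n * (h x - g x))    ≡⟨ cong (_+_ (∑ xs g)) (∑-*ˡ xs n _) ⟩
  ∑ xs g + n * ∑ xs (λ x → h x - g x)      ≡⟨ cong (λ t → ∑ xs g + n * t) (∑-- xs h g) ⟩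
  ∑ xs g + n * (∑ xs h - ∑ xs g)           ∎

∑-alternating : ∀ (xs : List A) (f g h k : A → ℤ) →
  ∑ xs (λ x → f x - g x - h x + k x) ≡ ∑ xs f - ∑ xs g - ∑ xs h + ∑ xs k
∑-alternating xs f g h k = begin
  ∑ xs (λ x → f x - g x - h x + k x)        ≡⟨ ∑-+ xs _ k ⟩
  ∑ xs (λ x → f x - g x - h x) + ∑ xs k     ≡⟨ cong (_+ ∑ xs k) (∑-- xs _ h) ⟩
  ∑ xs (λ x → f x - g x) - ∑ xs h + ∑ xs k  ≡⟨ cong (λ t → t - ∑ xs h + ∑ xs k) (∑-- xs f g) ⟩
  ∑ xs f - ∑ xs g - ∑ xs h + ∑ xs k         ∎

∑-++ : ∀ (xs ys : List A) (f : A → ℤ) → ∑ (xs ++ ys) f ≡ ∑ xs f + ∑ ys f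
∑-++ [] ys f = sym (+-identityˡ _)
∑-++ (x ∷ xs) ys f = trans (cong (_+_ (f x)) (∑-++ xs ys f)) (sym (+-assoc (f x) _ _))

∑-map : ∀ {B : Set} (g : A → B) (xs : List A) (f : B → ℤ) → ∑ (map g xs) f ≡ ∑ xs (f ∘ g)
∑-map g [] f = refl
∑-map g (x ∷ xs) f = cong (_+_ (f (g x))) (∑-map g xs f)

∑-concatMap : ∀ {B : Set} (h : A → List B) (xs : List A) (f : B → ℤ) →
  ∑ (concatMap h xs) f ≡ ∑ xs (λ x → ∑ (h x) f)
∑-concatMap h [] f = refl
∑-concatMap h (x ∷ xs) f = trans (∑-++ (h x) _ f) (cong (_+_ (∑ (h x) f)) (∑-concatMap h xs f))

∑-lookup : ∀ (xs : List A) (f : A → ℤ) → ∑ (allFin (length xs)) (f ∘ lookup xs) ≡ ∑ xs f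
∑-lookup xs f = begin
  ∑ (allFin (length xs)) (f ∘ lookup xs)  ≡⟨ ∑-map (lookup xs) (allFin (length xs)) f ⟨
  ∑ (map (lookup xs) (allFin (length xs))) f  ≡⟨ cong (λ ys → ∑ ys f) (map-tabulate id (lookup xs)) ⟩
  ∑ (tabulate (lookup xs)) f  ≡⟨ cong (λ ys → ∑ ys f) (tabulate-lookup xs) ⟩
  ∑ xs f  ∎

length-filter : ∀ {P : A → Set} (P? : ∀ x → Dec (P x)) (xs : List A) →
  + length (filter P? xs) ≡ ∑ xs (𝟙 ∘ P?)
length-filter P? [] = refl
length-filter P? (x ∷ xs) with P? x
... | yes _ = cong (_+_ (+ 1)) (length-filter P? xs)
... | no _ = trans (length-filter P? xs) (sym (+-identityˡ _))

wordSum : List A → ∀ ℓ → ((Fin ℓ → A) → ℤ) → ℤ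
wordSum L zero F = F []ᶠ
wordSum L (suc ℓ) F = ∑ L (λ c → wordSum L ℓ (F ∘ (c ∷ᶠ_)))

Extensional : ((Fin ℓ → A) → ℤ) → Set
Extensional F = ∀ {w w'} → w ≗ w' → F w ≡ F w'

extensional-∷ : ∀ {F : (Fin (suc ℓ) → A) → ℤ} (c : A) →
  Extensional F → Extensional (F ∘ (c ∷ᶠ_))
extensional-∷ c ext w≗w' = ext λ { zero → refl ; (suc i) → w≗w' i }

∑-allFuns : ∀ (L : List A) ℓ (F : (Fin ℓ → A) → ℤ) → Extensional F →
  ∑ (allFuns ℓ) (λ e → F (lookup L ∘ e)) ≡ wordSum L ℓ F
∑-allFuns L zero F ext = trans (+-identityʳ _) (ext λ ())
∑-allFuns L (suc ℓ) F ext = begin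
  ∑ (concatMap (λ x → map (x ∷ᶠ_) (allFuns ℓ)) (allFin (length L))) (λ e → F (lookup L ∘ e))
    ≡⟨ ∑-concatMap (λ x → map (x ∷ᶠ_) (allFuns ℓ)) (allFin (length L)) _ ⟩
  ∑ (allFin (length L)) (λ x → ∑ (map (x ∷ᶠ_) (allFuns ℓ)) (λ e → F (lookup L ∘ e)))
    ≡⟨ ∑-cong (allFin (length L)) (λ x → ∑-map (x ∷ᶠ_) (allFuns ℓ) _) ⟩
  ∑ (allFin (length L)) (λ x → ∑ (allFuns ℓ) (λ e → F (lookup L ∘ (x ∷ᶠ e))))
    ≡⟨ ∑-cong (allFin (length L)) (λ x → ∑-cong (allFuns ℓ) λ e →
         ext λ { zero → refl ; (suc i) → refl }) ⟩
  ∑ (allFin (length L)) (λ x → ∑ (allFuns ℓ) (λ e → F (lookup L x ∷ᶠ (lookup L ∘ e))))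
    ≡⟨ ∑-cong (allFin (length L)) (λ x → ∑-allFuns L ℓ _ (extensional-∷ (lookup L x) ext)) ⟩
  ∑ (allFin (length L)) (λ x → wordSum L ℓ (F ∘ (lookup L x ∷ᶠ_)))
    ≡⟨ ∑-lookup L (λ c → wordSum L ℓ (F ∘ (c ∷ᶠ_))) ⟩
  wordSum L (suc ℓ) F  ∎

count-as-wordSum : ∀ (L : List A) ℓ {P : (Fin ℓ → A) → Set} (P? : ∀ w → Dec (P w)) →
  (∀ {w w'} → w ≗ w' → P w → P w') →
  + length (filter (λ e → P? (lookup L ∘ e)) (allFuns ℓ)) ≡ wordSum L ℓ (𝟙 ∘ P?)
count-as-wordSum L ℓ P? resp = trans (length-filter _ (allFuns ℓ)) (∑-allFuns L ℓ (𝟙 ∘ P?) ext)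
  where
  ext : Extensional (𝟙 ∘ P?)
  ext w≗w' = 𝟙-cong (P? _) (P? _) (mk⇔ (resp w≗w') (resp (sym ∘ w≗w')))

-- The sum of F over words in B ∪ {a, b}, each word weighted by n ^ #a * m ^ #b.
weightedWordSum : List A → A → ℤ → A → ℤ → ∀ ℓ → ((Fin ℓ → A) → ℤ) → ℤ
weightedWordSum B a n b m zero F = F []ᶠ
weightedWordSum B a n b m (suc ℓ) F =
  ∑ B (λ c → weightedWordSum B a n b m ℓ (F ∘ (c ∷ᶠ_)))
    + n * weightedWordSum B a n b m ℓ (F ∘ (a ∷ᶠ_))
    + m * weightedWordSum B a n b m ℓ (F ∘ (b ∷ᶠ_))

wordSum-weighted : ∀ (L B : List A) (a : A) (n : ℤ) (b : A) (m : ℤ) →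
  (∀ G → ∑ L G ≡ ∑ B G + n * G a + m * G b) →
  ∀ ℓ F → wordSum L ℓ F ≡ weightedWordSum B a n b m ℓ F
wordSum-weighted L B a n b m L≈B zero F = refl
wordSum-weighted L B a n b m L≈B (suc ℓ) F =
  trans (L≈B (λ c → wordSum L ℓ (F ∘ (c ∷ᶠ_))))
        (cong₂ _+_ (cong₂ _+_ (∑-cong B (λ c → IH (F ∘ (c ∷ᶠ_)))) (cong (n *_) (IH _)))
                   (cong (m *_) (IH _)))
  where
  IH : ∀ F → wordSum L ℓ F ≡ weightedWordSum B a n b m ℓ F
  IH = wordSum-weighted L B a n b m L≈B ℓ

Avoids : A → ((Fin ℓ → A) → ℤ) → Set
Avoids a F = ∀ w i → w i ≡ a → F w ≡ + 0

AtMostOnce : A → ((Fin ℓ → A) → ℤ) → Set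
AtMostOnce a F = ∀ w i j → i ≢ j → w i ≡ a → w j ≡ a → F w ≡ + 0

NotBoth : A → A → ((Fin ℓ → A) → ℤ) → Set
NotBoth a b F = ∀ w i j → w i ≡ a → w j ≡ b → F w ≡ + 0

module _ {a : A} {F : (Fin (suc ℓ) → A) → ℤ} where

  avoids-∷ : ∀ c → Avoids a F → Avoids a (F ∘ (c ∷ᶠ_))
  avoids-∷ c avoids w i = avoids (c ∷ᶠ w) (suc i)

  atMostOnce-∷ : ∀ c → AtMostOnce a F → AtMostOnce a (F ∘ (c ∷ᶠ_))
  atMostOnce-∷ c once w i j i≢j = once (c ∷ᶠ w) (suc i) (suc j) (i≢j ∘ suc-injective)

  atMostOnce-∷-avoids : AtMostOnce a F → Avoids a (F ∘ (a ∷ᶠ_))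
  atMostOnce-∷-avoids once w i = once (a ∷ᶠ w) zero (suc i) (λ ()) refl

  notBoth-∷ : ∀ {b} c → NotBoth a b F → NotBoth a b (F ∘ (c ∷ᶠ_))
  notBoth-∷ c notBoth w i j = notBoth (c ∷ᶠ w) (suc i) (suc j)

  notBoth-∷-avoids : ∀ {b} → NotBoth a b F → Avoids b (F ∘ (a ∷ᶠ_))
  notBoth-∷-avoids notBoth w i = notBoth (a ∷ᶠ w) zero (suc i) refl

notBoth-sym : ∀ {a b : A} {F : (Fin ℓ → A) → ℤ} → NotBoth a b F → NotBoth b a F
notBoth-sym notBoth w i j wi≡b wj≡a = notBoth w j i wj≡a wi≡b

module _ (B : List A) (a b : A) where

  weightedWordSum-zero : ∀ n m ℓ {F} → (∀ w → F w ≡ + 0) → weightedWordSum B a n b m ℓ F ≡ + 0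
  weightedWordSum-zero n m zero F≗0 = F≗0 []ᶠ
  weightedWordSum-zero n m (suc ℓ) {F} F≗0 = begin
    ∑ B (λ c → W (F ∘ (c ∷ᶠ_))) + n * W (F ∘ (a ∷ᶠ_)) + m * W (F ∘ (b ∷ᶠ_))
      ≡⟨ cong₂ _+_ (cong₂ _+_ (∑-zero B zero∷) (cong (n *_) (zero∷ a))) (cong (m *_) (zero∷ b)) ⟩
    + 0 + n * + 0 + m * + 0
      ≡⟨ solve (n ∷ m ∷ []) ⟩
    + 0  ∎
    where
    W : ((Fin ℓ → A) → ℤ) → ℤ
    W = weightedWordSum B a n b m ℓ
    zero∷ : ∀ c → W (F ∘ (c ∷ᶠ_)) ≡ + 0
    zero∷ c = weightedWordSum-zero n m ℓ (λ w → F≗0 (c ∷ᶠ w))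

  weightedWordSum-avoids : ∀ n n' m ℓ {F} → Avoids a F →
    weightedWordSum B a n b m ℓ F ≡ weightedWordSum B a n' b m ℓ F
  weightedWordSum-avoids n n' m zero avoids = refl
  weightedWordSum-avoids n n' m (suc ℓ) {F} avoids =
    cong₂ _+_ (cong₂ _+_ (∑-cong B λ c → IH (avoids-∷ c avoids))
                         (trans (noA n) (sym (noA n'))))
              (cong (m *_) (IH (avoids-∷ b avoids)))
    where
    IH : ∀ {G} → Avoids a G → weightedWordSum B a n b m ℓ G ≡ weightedWordSum B a n' b m ℓ G
    IH = weightedWordSum-avoids n n' m ℓ
    noA : ∀ x → x * weightedWordSum B a x b m ℓ (F ∘ (a ∷ᶠ_)) ≡ + 0
    noA x = trans (cong (x *_) (weightedWordSum-zero x m ℓ (λ w → avoids (a ∷ᶠ w) zero refl))) (*-zeroʳ x)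

  weightedWordSum-affine : ∀ n m ℓ {F} → AtMostOnce a F →
    weightedWordSum B a n b m ℓ F
      ≡ weightedWordSum B a (+ 0) b m ℓ F
        + n * (weightedWordSum B a (+ 1) b m ℓ F - weightedWordSum B a (+ 0) b m ℓ F)
  weightedWordSum-affine n m zero {F} once = constant (F []ᶠ) n
    where
    constant : ∀ x n → x ≡ x + n * (x - x)
    constant = solve-∀
  weightedWordSum-affine n m (suc ℓ) {F} once = begin
    S n + n * Wa n + m * Wb n
      ≡⟨ cong₂ _+_ (cong₂ _+_ S-affine (cong (n *_) (Wa-constant n))) (cong (m *_) Wb-affine) ⟩
    (S₀ + n * (S₁ - S₀)) + n * Wa₀ + m * (Wb₀ + n * (Wb₁ - Wb₀))
      ≡⟨ regroup S₀ S₁ Wa₀ Wb₀ Wb₁ n m ⟩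
    (S₀ + + 0 * Wa₀ + m * Wb₀) + n * ((S₁ + + 1 * Wa₀ + m * Wb₁) - (S₀ + + 0 * Wa₀ + m * Wb₀))
      ≡⟨ cong (λ t → W₀ + n * ((S₁ + + 1 * t + m * Wb₁) - W₀)) (Wa-constant (+ 1)) ⟨
    W₀ + n * (weightedWordSum B a (+ 1) b m (suc ℓ) F - W₀)  ∎
    where
    W : ℤ → ((Fin ℓ → A) → ℤ) → ℤ
    W x = weightedWordSum B a x b m ℓ
    S Wa Wb : ℤ → ℤ
    S x = ∑ B (λ c → W x (F ∘ (c ∷ᶠ_)))
    Wa x = W x (F ∘ (a ∷ᶠ_))
    Wb x = W x (F ∘ (b ∷ᶠ_))
    S₀ S₁ Wa₀ Wb₀ Wb₁ W₀ : ℤ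
    S₀ = S (+ 0)
    S₁ = S (+ 1)
    Wa₀ = Wa (+ 0)
    Wb₀ = Wb (+ 0)
    Wb₁ = Wb (+ 1)
    W₀ = weightedWordSum B a (+ 0) b m (suc ℓ) F
    IH : ∀ {G} → AtMostOnce a G → W n G ≡ W (+ 0) G + n * (W (+ 1) G - W (+ 0) G)
    IH = weightedWordSum-affine n m ℓ
    S-affine : S n ≡ S₀ + n * (S₁ - S₀)
    S-affine = ∑-affine B n (λ c → IH (atMostOnce-∷ c once))
    Wa-constant : ∀ x → Wa x ≡ Wa₀
    Wa-constant x = weightedWordSum-avoids x (+ 0) m ℓ (atMostOnce-∷-avoids once)
    Wb-affine : Wb n ≡ Wb₀ + n * (Wb₁ - Wb₀)
    Wb-affine = IH (atMostOnce-∷ b once)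
    regroup : ∀ s₀ s₁ a₀ b₀ b₁ n m →
      (s₀ + n * (s₁ - s₀)) + n * a₀ + m * (b₀ + n * (b₁ - b₀))
        ≡ (s₀ + + 0 * a₀ + m * b₀) + n * ((s₁ + + 1 * a₀ + m * b₁) - (s₀ + + 0 * a₀ + m * b₀))
    regroup = solve-∀

weightedWordSum-swap : ∀ (B : List A) a n b m ℓ F →
  weightedWordSum B a n b m ℓ F ≡ weightedWordSum B b m a n ℓ F
weightedWordSum-swap B a n b m zero F = refl
weightedWordSum-swap {A = A} B a n b m (suc ℓ) F = begin
  ∑ B (λ c → W (F ∘ (c ∷ᶠ_))) + n * W (F ∘ (a ∷ᶠ_)) + m * W (F ∘ (b ∷ᶠ_))
    ≡⟨ cong₂ _+_ (cong₂ _+_ (∑-cong B λ c → IH (F ∘ (c ∷ᶠ_))) (cong (n *_) (IH _)))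
                 (cong (m *_) (IH _)) ⟩
  ∑ B (λ c → W' (F ∘ (c ∷ᶠ_))) + n * W' (F ∘ (a ∷ᶠ_)) + m * W' (F ∘ (b ∷ᶠ_))
    ≡⟨ xy∙z≈xz∙y (∑ B (λ c → W' (F ∘ (c ∷ᶠ_)))) _ _ ⟩
  ∑ B (λ c → W' (F ∘ (c ∷ᶠ_))) + m * W' (F ∘ (b ∷ᶠ_)) + n * W' (F ∘ (a ∷ᶠ_))  ∎
  where
  W W' : ((Fin ℓ → A) → ℤ) → ℤ
  W = weightedWordSum B a n b m ℓ
  W' = weightedWordSum B b m a n ℓ
  IH : ∀ G → W G ≡ W' G
  IH = weightedWordSum-swap B a n b m ℓ

module _ (B : List A) (a b : A) where

  private
    W : ℤ → ℤ → ∀ ℓ → ((Fin ℓ → A) → ℤ) → ℤ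
    W n m = weightedWordSum B a n b m

  weightedWordSum-affine₂ : ∀ n m ℓ {F} → AtMostOnce b F →
    W n m ℓ F ≡ W n (+ 0) ℓ F + m * (W n (+ 1) ℓ F - W n (+ 0) ℓ F)
  weightedWordSum-affine₂ n m ℓ {F} once = begin
    W n m ℓ F
      ≡⟨ weightedWordSum-swap B a n b m ℓ F ⟩
    weightedWordSum B b m a n ℓ F
      ≡⟨ weightedWordSum-affine B b a m n ℓ once ⟩
    weightedWordSum B b (+ 0) a n ℓ F
      + m * (weightedWordSum B b (+ 1) a n ℓ F - weightedWordSum B b (+ 0) a n ℓ F)
      ≡⟨ cong₂ (λ p q → p + m * (q - p)) (weightedWordSum-swap B a n b _ ℓ F)
                                          (weightedWordSum-swap B a n b _ ℓ F) ⟨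
    W n (+ 0) ℓ F + m * (W n (+ 1) ℓ F - W n (+ 0) ℓ F)  ∎

  weightedWordSum-avoids₂ : ∀ n m m' ℓ {F} → Avoids b F → W n m ℓ F ≡ W n m' ℓ F
  weightedWordSum-avoids₂ n m m' ℓ {F} avoids = begin
    W n m ℓ F                      ≡⟨ weightedWordSum-swap B a n b m ℓ F ⟩
    weightedWordSum B b m a n ℓ F   ≡⟨ weightedWordSum-avoids B b a m m' n ℓ avoids ⟩
    weightedWordSum B b m' a n ℓ F  ≡⟨ weightedWordSum-swap B a n b m' ℓ F ⟨
    W n m' ℓ F                     ∎

  mixedDifference : ∀ ℓ → ((Fin ℓ → A) → ℤ) → ℤ
  mixedDifference ℓ F = W (+ 1) (+ 1) ℓ F - W (+ 1) (+ 0) ℓ F - W (+ 0) (+ 1) ℓ F + W (+ 0) (+ 0) ℓ F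

  weightedWordSum-bilinear : ∀ n m ℓ {F} → AtMostOnce a F → AtMostOnce b F →
    W n m ℓ F ≡ n * W (+ 1) (+ 0) ℓ F + m * W (+ 0) (+ 1) ℓ F
                - (n + m - + 1) * W (+ 0) (+ 0) ℓ F + n * m * mixedDifference ℓ F
  weightedWordSum-bilinear n m ℓ {F} onceA onceB = begin
    W n m ℓ F
      ≡⟨ weightedWordSum-affine B a b n m ℓ onceA ⟩
    W (+ 0) m ℓ F + n * (W (+ 1) m ℓ F - W (+ 0) m ℓ F)
      ≡⟨ cong₂ (λ p q → p + n * (q - p)) (weightedWordSum-affine₂ _ m ℓ onceB)
                                          (weightedWordSum-affine₂ _ m ℓ onceB) ⟩
    (W₀₀ + m * (W₀₁ - W₀₀))
      + n * ((W₁₀ + m * (W₁₁ - W₁₀)) - (W₀₀ + m * (W₀₁ - W₀₀)))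
      ≡⟨ interpolate W₀₀ W₁₀ W₀₁ W₁₁ n m ⟩
    n * W₁₀ + m * W₀₁ - (n + m - + 1) * W₀₀ + n * m * (W₁₁ - W₁₀ - W₀₁ + W₀₀)  ∎
    where
    W₀₀ W₁₀ W₀₁ W₁₁ : ℤ
    W₀₀ = W (+ 0) (+ 0) ℓ F
    W₁₀ = W (+ 1) (+ 0) ℓ F
    W₀₁ = W (+ 0) (+ 1) ℓ F
    W₁₁ = W (+ 1) (+ 1) ℓ F
    interpolate : ∀ w₀₀ w₁₀ w₀₁ w₁₁ n m →
      (w₀₀ + m * (w₀₁ - w₀₀))
        + n * ((w₁₀ + m * (w₁₁ - w₁₀)) - (w₀₀ + m * (w₀₁ - w₀₀)))
        ≡ n * w₁₀ + m * w₀₁ - (n + m - + 1) * w₀₀ + n * m * (w₁₁ - w₁₀ - w₀₁ + w₀₀)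
    interpolate = solve-∀

  mixedDifference-suc : ∀ ℓ F →
    mixedDifference (suc ℓ) F
      ≡ ∑ B (λ c → mixedDifference ℓ (F ∘ (c ∷ᶠ_)))
        + (W (+ 1) (+ 1) ℓ (F ∘ (a ∷ᶠ_)) - W (+ 1) (+ 0) ℓ (F ∘ (a ∷ᶠ_)))
        + (W (+ 1) (+ 1) ℓ (F ∘ (b ∷ᶠ_)) - W (+ 0) (+ 1) ℓ (F ∘ (b ∷ᶠ_)))
  mixedDifference-suc ℓ F =
    trans (regroup (S (+ 1) (+ 1)) (S (+ 1) (+ 0)) (S (+ 0) (+ 1)) (S (+ 0) (+ 0))
                   (Wa (+ 1) (+ 1)) (Wa (+ 1) (+ 0)) (Wa (+ 0) (+ 1)) (Wa (+ 0) (+ 0))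
                   (Wb (+ 1) (+ 1)) (Wb (+ 1) (+ 0)) (Wb (+ 0) (+ 1)) (Wb (+ 0) (+ 0)))
          (cong₂ _+_ (cong₂ _+_ (sym (∑-alternating B _ _ _ _)) refl) refl)
    where
    S Wa Wb : ℤ → ℤ → ℤ
    S n m = ∑ B (λ c → W n m ℓ (F ∘ (c ∷ᶠ_)))
    Wa n m = W n m ℓ (F ∘ (a ∷ᶠ_))
    Wb n m = W n m ℓ (F ∘ (b ∷ᶠ_))
    regroup : ∀ s₁₁ s₁₀ s₀₁ s₀₀ a₁₁ a₁₀ a₀₁ a₀₀ b₁₁ b₁₀ b₀₁ b₀₀ →
      (s₁₁ + + 1 * a₁₁ + + 1 * b₁₁) - (s₁₀ + + 1 * a₁₀ + + 0 * b₁₀)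
        - (s₀₁ + + 0 * a₀₁ + + 1 * b₀₁) + (s₀₀ + + 0 * a₀₀ + + 0 * b₀₀)
        ≡ (s₁₁ - s₁₀ - s₀₁ + s₀₀) + (a₁₁ - a₁₀) + (b₁₁ - b₀₁)
    regroup = solve-∀

  mixedDifference-notBoth : ∀ ℓ {F} → NotBoth a b F → mixedDifference ℓ F ≡ + 0
  mixedDifference-notBoth zero {F} _ = cancel (F []ᶠ)
    where
    cancel : ∀ x → x - x - x + x ≡ + 0
    cancel = solve-∀
  mixedDifference-notBoth (suc ℓ) {F} notBoth = begin
    mixedDifference (suc ℓ) F
      ≡⟨ mixedDifference-suc ℓ F ⟩
    ∑ B (λ c → mixedDifference ℓ (F ∘ (c ∷ᶠ_))) + (Wa₁₁ - Wa₁₀) + (Wb₁₁ - Wb₀₁)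
      ≡⟨ cong₂ _+_ (cong₂ _+_ (∑-zero B λ c → mixedDifference-notBoth ℓ (notBoth-∷ c notBoth))
                              (cong (_- Wa₁₀) (weightedWordSum-avoids₂ _ _ _ ℓ (notBoth-∷-avoids notBoth))))
                   (cong (_- Wb₀₁) (weightedWordSum-avoids B a b _ _ _ ℓ
                                      (notBoth-∷-avoids (notBoth-sym notBoth)))) ⟩
    + 0 + (Wa₁₀ - Wa₁₀) + (Wb₀₁ - Wb₀₁)
      ≡⟨ cancel Wa₁₀ Wb₀₁ ⟩
    + 0  ∎
    where
    Wa₁₁ Wa₁₀ Wb₁₁ Wb₀₁ : ℤ
    Wa₁₁ = W (+ 1) (+ 1) ℓ (F ∘ (a ∷ᶠ_))
    Wa₁₀ = W (+ 1) (+ 0) ℓ (F ∘ (a ∷ᶠ_))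
    Wb₁₁ = W (+ 1) (+ 1) ℓ (F ∘ (b ∷ᶠ_))
    Wb₀₁ = W (+ 0) (+ 1) ℓ (F ∘ (b ∷ᶠ_))
    cancel : ∀ x y → + 0 + (x - x) + (y - y) ≡ + 0
    cancel = solve-∀

  mixedDifference-one : ∀ F → mixedDifference 1 F ≡ + 0
  mixedDifference-one F = cancel (∑ B (λ c → F (c ∷ᶠ []ᶠ))) (F (a ∷ᶠ []ᶠ)) (F (b ∷ᶠ []ᶠ))
    where
    cancel : ∀ s x y → (s + + 1 * x + + 1 * y) - (s + + 1 * x + + 0 * y)
                         - (s + + 0 * x + + 1 * y) + (s + + 0 * x + + 0 * y) ≡ + 0
    cancel = solve-∀

  mixedDifference-two : ∀ F → mixedDifference 2 F ≡ F (a ∷ᶠ b ∷ᶠ []ᶠ) + F (b ∷ᶠ a ∷ᶠ []ᶠ)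
  mixedDifference-two F = begin
    mixedDifference 2 F
      ≡⟨ mixedDifference-suc 1 F ⟩
    ∑ B (λ c → mixedDifference 1 (F ∘ (c ∷ᶠ_))) + (W (+ 1) (+ 1) 1 Fa - W (+ 1) (+ 0) 1 Fa)
      + (W (+ 1) (+ 1) 1 Fb - W (+ 0) (+ 1) 1 Fb)
      ≡⟨ cong₂ _+_ (cong₂ _+_ (∑-zero B λ c → mixedDifference-one (F ∘ (c ∷ᶠ_))) refl) refl ⟩
    + 0 + (W (+ 1) (+ 1) 1 Fa - W (+ 1) (+ 0) 1 Fa) + (W (+ 1) (+ 1) 1 Fb - W (+ 0) (+ 1) 1 Fb)
      ≡⟨ pick (∑ B (λ c → Fa (c ∷ᶠ []ᶠ))) (F (a ∷ᶠ a ∷ᶠ []ᶠ)) (F (a ∷ᶠ b ∷ᶠ []ᶠ))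
              (∑ B (λ c → Fb (c ∷ᶠ []ᶠ))) (F (b ∷ᶠ a ∷ᶠ []ᶠ)) (F (b ∷ᶠ b ∷ᶠ []ᶠ)) ⟩
    F (a ∷ᶠ b ∷ᶠ []ᶠ) + F (b ∷ᶠ a ∷ᶠ []ᶠ)  ∎
    where
    Fa Fb : (Fin 1 → A) → ℤ
    Fa = F ∘ (a ∷ᶠ_)
    Fb = F ∘ (b ∷ᶠ_)
    pick : ∀ sa xaa xab sb xba xbb →
      + 0 + ((sa + + 1 * xaa + + 1 * xab) - (sa + + 1 * xaa + + 0 * xab))
          + ((sb + + 1 * xba + + 1 * xbb) - (sb + + 0 * xba + + 1 * xbb)) ≡ xab + xba
    pick = solve-∀

module _ (_≟_ : DecidableEquality A) where

  multiplicity : A → List A → ℕ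
  multiplicity a = length ∘ filter (_≟ a)

  removeBoth : A → A → List A → List A
  removeBoth a b = filter (λ x → ¬? ((x ≟ a) ⊎-dec (x ≟ b)))

  ∑-removeBoth : ∀ (xs : List A) {a b} → a ≢ b → ∀ G →
    ∑ xs G ≡ ∑ (removeBoth a b xs) G + + multiplicity a xs * G a + + multiplicity b xs * G b
  ∑-removeBoth [] {a} {b} _ G = sym (vanish (G a) (G b))
    where
    vanish : ∀ x y → + 0 + + 0 * x + + 0 * y ≡ + 0
    vanish = solve-∀
  ∑-removeBoth (x ∷ xs) {a} {b} a≢b G with x ≟ a | x ≟ b
  ... | yes refl | yes refl = ⊥-elim (a≢b refl)
  ... | yes refl | no _ =
    trans (cong (_+_ (G a)) (∑-removeBoth xs a≢b G))
          (moveA (G a) (∑ (removeBoth a b xs) G) (+ multiplicity a xs) (+ multiplicity b xs) (G b))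
    where
    moveA : ∀ x r na nb y → x + (r + na * x + nb * y) ≡ r + (+ 1 + na) * x + nb * y
    moveA = solve-∀
  ... | no _ | yes refl =
    trans (cong (_+_ (G b)) (∑-removeBoth xs a≢b G))
          (moveB (G b) (∑ (removeBoth a b xs) G) (+ multiplicity a xs) (G a) (+ multiplicity b xs))
    where
    moveB : ∀ y r na x nb → y + (r + na * x + nb * y) ≡ r + na * x + (+ 1 + nb) * y
    moveB = solve-∀
  ... | no _ | no _ =
    trans (cong (_+_ (G x)) (∑-removeBoth xs a≢b G))
          (reassoc (G x) (∑ (removeBoth a b xs) G) (+ multiplicity a xs * G a) (+ multiplicity b xs * G b))
    where
    reassoc : ∀ z r p q → z + (r + p + q) ≡ z + r + p + q
    reassoc = solve-∀

  count-removal : ∀ (xs : List A) {a b} → a ≢ b → ∀ {ℓ F} (count : List A → ℤ) →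
    (∀ L → count L ≡ wordSum L ℓ F) → AtMostOnce a F → AtMostOnce b F →
    let B = removeBoth a b xs
        n = + multiplicity a xs
        m = + multiplicity b xs
    in ∀ {d} → mixedDifference B a b ℓ F ≡ d →
       count xs ≡ n * count (a ∷ B) + m * count (b ∷ B) - (n + m - + 1) * count B + n * m * d
  count-removal xs {a} {b} a≢b {ℓ} {F} count count≡wordSum onceA onceB refl = begin
    count xs
      ≡⟨ count≡wordSum xs ⟩
    wordSum xs ℓ F
      ≡⟨ wordSum-weighted xs B a n b m (∑-removeBoth xs a≢b) ℓ F ⟩
    weightedWordSum B a n b m ℓ F
      ≡⟨ weightedWordSum-bilinear B a b n m ℓ onceA onceB ⟩
    n * W (+ 1) (+ 0) + m * W (+ 0) (+ 1) - (n + m - + 1) * W (+ 0) (+ 0) + n * m * mixedDifference B a b ℓ F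
      ≡⟨ combination-cong {n} {m} {mixedDifference B a b ℓ F}
                          (as-count (a ∷ B) (+ 1) (+ 0) (λ G → withA (∑ B G) (G a) (G b)))
                          (as-count (b ∷ B) (+ 0) (+ 1) (λ G → withB (∑ B G) (G a) (G b)))
                          (as-count B (+ 0) (+ 0) (λ G → without (∑ B G) (G a) (G b))) ⟩
    n * count (a ∷ B) + m * count (b ∷ B) - (n + m - + 1) * count B + n * m * mixedDifference B a b ℓ F  ∎
    where
    B : List A
    B = removeBoth a b xs
    n m : ℤ
    n = + multiplicity a xs
    m = + multiplicity b xs
    W : ℤ → ℤ → ℤ
    W x y = weightedWordSum B a x b y ℓ F
    as-count : ∀ L x y → (∀ G → ∑ L G ≡ ∑ B G + x * G a + y * G b) → W x y ≡ count L
    as-count L x y L≈B = sym (trans (count≡wordSum L) (wordSum-weighted L B a x b y L≈B ℓ F))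
    combination-cong : ∀ {n m d x x' y y' z z' : ℤ} → x ≡ x' → y ≡ y' → z ≡ z' →
      n * x + m * y - (n + m - + 1) * z + n * m * d ≡ n * x' + m * y' - (n + m - + 1) * z' + n * m * d
    combination-cong refl refl refl = refl
    withA : ∀ s x y → x + s ≡ s + + 1 * x + + 0 * y
    withA = solve-∀
    withB : ∀ s x y → y + s ≡ s + + 0 * x + + 1 * y
    withB = solve-∀
    without : ∀ s x y → s ≡ s + + 0 * x + + 0 * y
    without = solve-∀

injective-resp : ∀ {N} {f g : Fin ℓ → Fin N} → f ≗ g → Injective f → Injective g
injective-resp f≗g inj i j gi≡gj = inj i j (trans (f≗g i) (trans gi≡gj (sym (f≗g j))))

Consecutive : ∀ {N} k → (Fin (suc k) → Arc N) → Set
Consecutive k w = ∀ (i : Fin k) → proj₂ (w (inject₁ i)) ≡ proj₁ (w (suc i))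

consecutive? : ∀ {N} k (w : Fin (suc k) → Arc N) → Dec (Consecutive k w)
consecutive? k w = all? λ i → proj₂ (w (inject₁ i)) ≟F proj₁ (w (suc i))

consecutive-resp : ∀ {N} k {w w' : Fin (suc k) → Arc N} → w ≗ w' → Consecutive k w → Consecutive k w'
consecutive-resp k w≗w' consecutive i =
  trans (sym (cong proj₂ (w≗w' (inject₁ i)))) (trans (consecutive i) (cong proj₁ (w≗w' (suc i))))

-- IsCycleWord k (lookup D ∘ e) unfolds to IsCycleSeq D k e.
IsCycleWord : ∀ {N} k → (Fin (suc k) → Arc N) → Set
IsCycleWord k w =
    Consecutive k w
  × (proj₂ (w (fromℕ k)) ≡ proj₁ (w zero))
  × Injective (proj₁ ∘ w)
  × (∀ i → proj₁ (w zero) ≤ proj₁ (w i))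

isCycleWord? : ∀ {N} k (w : Fin (suc k) → Arc N) → Dec (IsCycleWord k w)
isCycleWord? k w =
       consecutive? k w
  ×-dec (proj₂ (w (fromℕ k)) ≟F proj₁ (w zero))
  ×-dec injective? (proj₁ ∘ w)
  ×-dec all? (λ i → proj₁ (w zero) ≤? proj₁ (w i))

isCycleWord-resp : ∀ {N} k {w w' : Fin (suc k) → Arc N} → w ≗ w' → IsCycleWord k w → IsCycleWord k w'
isCycleWord-resp k {w} {w'} w≗w' (consecutive , closing , injective , canonical) =
    consecutive-resp k w≗w' consecutive
  , trans (sym (cong proj₂ (w≗w' (fromℕ k)))) (trans closing (tail≗ zero))
  , injective-resp tail≗ injective
  , (λ i → subst₂ _≤_ (tail≗ zero) (tail≗ i) (canonical i))
  where
  tail≗ : proj₁ ∘ w ≗ proj₁ ∘ w'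
  tail≗ i = cong proj₁ (w≗w' i)

isCycle : ∀ {N} ℓ → (Fin ℓ → Arc N) → ℤ
isCycle zero _ = + 0
isCycle (suc k) = 𝟙 ∘ isCycleWord? k

σ-as-wordSum : ∀ {N} ℓ (D : Digraph N) → σ D ℓ ≡ wordSum D ℓ (isCycle ℓ)
σ-as-wordSum zero D = refl
σ-as-wordSum (suc k) D = count-as-wordSum D (suc k) (isCycleWord? k) (isCycleWord-resp k)

isCycle-atMostOnce : ∀ {N} ℓ (c : Arc N) → AtMostOnce c (isCycle ℓ)
isCycle-atMostOnce zero c w ()
isCycle-atMostOnce (suc k) c w i j i≢j wi≡c wj≡c =
  𝟙-no (isCycleWord? k w) λ (_ , _ , injective , _) →
    i≢j (injective i j (cong proj₁ (trans wi≡c (sym wj≡c))))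

CyclicSuccessor : ∀ {k} → Fin (suc k) → Fin (suc k) → Set
CyclicSuccessor {k} i i' = toℕ i' ≡ suc (toℕ i) ⊎ (toℕ i ≡ k × toℕ i' ≡ 0)

isCycleWord-successor : ∀ {N} k {w : Fin (suc k) → Arc N} → IsCycleWord k w →
  ∀ i → Σ (Fin (suc k)) λ i' → CyclicSuccessor i i' × proj₂ (w i) ≡ proj₁ (w i')
isCycleWord-successor k (consecutive , closing , _) i with view i
... | ‵fromℕ = zero , inj₂ (toℕ-fromℕ k , refl) , closing
... | ‵inject₁ j = suc j , inj₁ (cong suc (sym (toℕ-inject₁ j))) , consecutive j

cyclicSuccessor-involution : ∀ {k} {i j : Fin (suc k)} →
  CyclicSuccessor i j → CyclicSuccessor j i → i ≡ j ⊎ k ≡ 1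
cyclicSuccessor-involution {i = i} (inj₁ j≡1+i) (inj₁ i≡1+j) =
  ⊥-elim (m≢1+n+m (toℕ i) (trans i≡1+j (cong suc j≡1+i)))
cyclicSuccessor-involution (inj₁ j≡1+i) (inj₂ (j≡k , i≡0)) =
  inj₂ (trans (sym j≡k) (trans j≡1+i (cong suc i≡0)))
cyclicSuccessor-involution (inj₂ (i≡k , j≡0)) (inj₁ i≡1+j) =
  inj₂ (trans (sym i≡k) (trans i≡1+j (cong suc j≡0)))
cyclicSuccessor-involution (inj₂ (_ , j≡0)) (inj₂ (_ , i≡0)) =
  inj₁ (toℕ-injective (trans i≡0 (sym j≡0)))

isCycleWord-follows : ∀ {N} k {w : Fin (suc k) → Arc N} → IsCycleWord k w →
  ∀ {i j} → proj₂ (w i) ≡ proj₁ (w j) → CyclicSuccessor i j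
isCycleWord-follows k cycle@(_ , _ , injective , _) {i} {j} head≡tail
  with isCycleWord-successor k cycle i
... | i' , i↦i' , head≡tail' =
  subst (CyclicSuccessor i) (injective i' j (trans (sym head≡tail') head≡tail)) i↦i'

isCycleWord-antiparallel : ∀ {N} k {u v : Fin N} {w} → u ≢ v → IsCycleWord k w →
  ∀ {i j} → w i ≡ (u , v) → w j ≡ (v , u) → k ≡ 1
isCycleWord-antiparallel k {w = w} u≢v cycle {i} {j} wi≡uv wj≡vu
  with cyclicSuccessor-involution
         (isCycleWord-follows k cycle (trans (cong proj₂ wi≡uv) (sym (cong proj₁ wj≡vu))))
         (isCycleWord-follows k cycle (trans (cong proj₂ wj≡vu) (sym (cong proj₁ wi≡uv))))
... | inj₁ i≡j = ⊥-elim (u≢v (cong proj₁ (trans (sym wi≡uv) (trans (cong w i≡j) wj≡vu))))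
... | inj₂ k≡1 = k≡1

twoCycle : ∀ {N} → Fin N → Fin N → Fin 2 → Arc N
twoCycle x y = (x , y) ∷ᶠ (y , x) ∷ᶠ []ᶠ

twoCycle-isCycleWord : ∀ {N} {x y : Fin N} → x ≢ y → x ≤ y → IsCycleWord 1 (twoCycle x y)
twoCycle-isCycleWord {x = x} {y} x≢y x≤y =
  (λ { zero → refl }) , refl , injective , λ { zero → ≤-refl ; (suc zero) → x≤y }
  where
  injective : Injective (proj₁ ∘ twoCycle x y)
  injective zero zero _ = refl
  injective zero (suc zero) x≡y = ⊥-elim (x≢y x≡y)
  injective (suc zero) zero y≡x = ⊥-elim (x≢y (sym y≡x))
  injective (suc zero) (suc zero) _ = refl

twoCycle-ordered : ∀ {N} {x y : Fin N} → IsCycleWord 1 (twoCycle x y) → x ≤ y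
twoCycle-ordered (_ , _ , _ , minimal) = minimal (suc zero)

-- Exactly one of the two rotations starts at the smaller vertex.
isCycle-twoCycle : ∀ {N} {u v : Fin N} → u ≢ v →
  isCycle 2 (twoCycle u v) + isCycle 2 (twoCycle v u) ≡ + 1
isCycle-twoCycle {u = u} {v} u≢v with ≤-total u v
... | inj₁ u≤v =
  cong₂ _+_ (𝟙-yes (isCycleWord? 1 (twoCycle u v)) (twoCycle-isCycleWord u≢v u≤v))
            (𝟙-no (isCycleWord? 1 (twoCycle v u)) λ cycle →
               u≢v (≤-antisym u≤v (twoCycle-ordered cycle)))
... | inj₂ v≤u =
  cong₂ _+_ (𝟙-no (isCycleWord? 1 (twoCycle u v)) λ cycle →
               u≢v (≤-antisym (twoCycle-ordered cycle) v≤u))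
            (𝟙-yes (isCycleWord? 1 (twoCycle v u)) (twoCycle-isCycleWord (u≢v ∘ sym) v≤u))

isCycle-mixedDifference : ∀ {N} {u v : Fin N} → u ≢ v → ∀ B ℓ →
  mixedDifference B (u , v) (v , u) ℓ (isCycle ℓ) ≡ X^ 2 ℓ
isCycle-mixedDifference u≢v B zero = refl
isCycle-mixedDifference u≢v B 1 = mixedDifference-one B _ _ (isCycle 1)
isCycle-mixedDifference u≢v B 2 = trans (mixedDifference-two B _ _ (isCycle 2)) (isCycle-twoCycle u≢v)
isCycle-mixedDifference u≢v B (suc (suc (suc k))) = mixedDifference-notBoth B _ _ (suc (suc (suc k))) notBoth
  where
  notBoth : NotBoth _ _ (isCycle (suc (suc (suc k))))
  notBoth w i j wi≡uv wj≡vu =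
    𝟙-no (isCycleWord? _ w) λ cycle → case isCycleWord-antiparallel _ u≢v cycle wi≡uv wj≡vu of λ ()

pathVertices : ∀ {N} k → (Fin (suc k) → Arc N) → Fin (suc (suc k)) → Fin N
pathVertices k w zero = proj₁ (w zero)
pathVertices k w (suc i) = proj₂ (w i)

IsPathWord : ∀ {N} k → (Fin (suc k) → Arc N) → Set
IsPathWord k w = Consecutive k w × Injective (pathVertices k w)

isPathWord? : ∀ {N} k (w : Fin (suc k) → Arc N) → Dec (IsPathWord k w)
isPathWord? k w = consecutive? k w ×-dec injective? (pathVertices k w)

isPathWord-resp : ∀ {N} k {w w' : Fin (suc k) → Arc N} → w ≗ w' → IsPathWord k w → IsPathWord k w'
isPathWord-resp k w≗w' (consecutive , injective) =
    consecutive-resp k w≗w' consecutive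
  , injective-resp (λ { zero → cong proj₁ (w≗w' zero) ; (suc i) → cong proj₂ (w≗w' i) }) injective

isPath : ∀ {N} ℓ → (Fin ℓ → Arc N) → ℤ
isPath zero _ = + 0
isPath (suc k) = 𝟙 ∘ isPathWord? k

π-as-wordSum : ∀ {N} ℓ (D : Digraph N) → π D ℓ ≡ wordSum D ℓ (isPath ℓ)
π-as-wordSum zero D = refl
π-as-wordSum (suc k) D =
  trans (cong (+_ ∘ length) (filter-≐ (isPathSeq? D k) (λ e → isPathWord? k (lookup D ∘ e))
                                      (toWord , fromWord) (allFuns (suc k))))
        (count-as-wordSum D (suc k) (isPathWord? k) (isPathWord-resp k))
  where
  vertices≗ : ∀ e → pathVerts D k e ≗ pathVertices k (lookup D ∘ e)
  vertices≗ e zero = refl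
  vertices≗ e (suc i) = refl
  toWord : ∀ {e} → IsPathSeq D k e → IsPathWord k (lookup D ∘ e)
  toWord {e} (consecutive , injective) = consecutive , injective-resp (vertices≗ e) injective
  fromWord : ∀ {e} → IsPathWord k (lookup D ∘ e) → IsPathSeq D k e
  fromWord {e} (consecutive , injective) = consecutive , injective-resp (sym ∘ vertices≗ e) injective

isPath-atMostOnce : ∀ {N} ℓ (c : Arc N) → AtMostOnce c (isPath ℓ)
isPath-atMostOnce zero c w ()
isPath-atMostOnce (suc k) c w i j i≢j wi≡c wj≡c =
  𝟙-no (isPathWord? k w) λ (_ , injective) →
    i≢j (suc-injective (injective (suc i) (suc j) (cong proj₂ (trans wi≡c (sym wj≡c)))))

pathVertices-inject₁ : ∀ {N} k {w : Fin (suc k) → Arc N} →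
  Consecutive k w → ∀ i → pathVertices k w (inject₁ i) ≡ proj₁ (w i)
pathVertices-inject₁ k consecutive zero = refl
pathVertices-inject₁ (suc k) consecutive (suc i) = consecutive i

isPath-notBoth : ∀ {N} ℓ (u v : Fin N) → NotBoth (u , v) (v , u) (isPath ℓ)
isPath-notBoth zero u v w ()
isPath-notBoth (suc k) u v w i j wi≡uv wj≡vu = 𝟙-no (isPathWord? k w) λ (consecutive , injective) →
  let vertex = pathVertices-inject₁ k consecutive
      1+i≡j = injective (suc i) (inject₁ j)
                (trans (cong proj₂ wi≡uv) (trans (sym (cong proj₁ wj≡vu)) (sym (vertex j))))
      1+j≡i = injective (suc j) (inject₁ i)
                (trans (cong proj₂ wj≡vu) (trans (sym (cong proj₁ wi≡uv)) (sym (vertex i))))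
  in m≢1+n+m (toℕ i) (trans (sym (trans (cong toℕ 1+j≡i) (toℕ-inject₁ i)))
                            (cong suc (sym (trans (cong toℕ 1+i≡j) (toℕ-inject₁ j)))))

isPath-mixedDifference : ∀ {N} (u v : Fin N) B ℓ → mixedDifference B (u , v) (v , u) ℓ (isPath ℓ) ≡ + 0
isPath-mixedDifference u v B ℓ = mixedDifference-notBoth B _ _ ℓ (isPath-notBoth ℓ u v)

theorem2p3 : ∀ {N : ℕ} (D : Digraph N) (u v : Fin N) (n m : ℕ) →
    u ≢ v → mult D u v ≡ n → mult D v u ≡ m →
    let D₃ = deleteBoth D u v
        D₁ = addArc D₃ u v
        D₂ = addArc D₃ v u
    in (∀ k → σ D k ≡ + n * σ D₁ k + + m * σ D₂ k
                      - (+ n + + m - + 1) * σ D₃ k + + n * + m * X^ 2 k)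
     × (∀ k → π D k ≡ + n * π D₁ k + + m * π D₂ k
                      - (+ n + + m - + 1) * π D₃ k)
theorem2p3 D u v _ _ u≢v refl refl =
    (λ ℓ → count-removal _≟A_ D uv≢vu (λ L → σ L ℓ) (σ-as-wordSum ℓ)
             (isCycle-atMostOnce ℓ _) (isCycle-atMostOnce ℓ _) (isCycle-mixedDifference u≢v _ ℓ))
  , (λ ℓ → trans (count-removal _≟A_ D uv≢vu (λ L → π L ℓ) (π-as-wordSum ℓ)
                    (isPath-atMostOnce ℓ _) (isPath-atMostOnce ℓ _) (isPath-mixedDifference u v _ ℓ))
                 (drop-zero-term (+ mult D u v * + mult D v u)))
  where
  uv≢vu : (u , v) ≢ (v , u)
  uv≢vu = u≢v ∘ cong proj₁
  drop-zero-term : ∀ {x} y → x + y * + 0 ≡ x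
  drop-zero-term {x} y = trans (cong (_+_ x) (*-zeroʳ y)) (+-identityʳ x)
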